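{- Let $K$ be a field. For all natural numbers $d,l$ there exists a natural number $M$ such that for every sequence $I_0,\dots,I_M$ of monomial ideals in $K[X_d,\dots,X_0,Y]$ with $\mathrm{deg}(I_i)\le l+i$ for all $i\le M$, there exist $i<j\le M$ with $I_i\supseteq I_j$.
   Context: A monomial in $K[X_d,\dots,X_0,Y]$ is a polynomial of the form $X_d^{i_d}\cdots X_0^{i_0}Y^j$; its degree is the total degree $i_d+\dots+i_0+j$. A monomial ideal is an ideal generated by monomials. The degree of a finite set $G$ of monomials is $\max\{\mathrm{deg}(m): m\in G\}$. The degree of a monomial ideal $I$ is $\mathrm{deg}(I)=\min\{\mathrm{deg}(G): G \text{ a finite set of monomials with } I=\langle G\rangle\}$. -}

module Defs where

open import Data.Nat using (ℕ; suc; _≤_)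
open import Data.Vec using (Vec; sum)
open import Data.Vec.Relation.Binary.Pointwise.Inductive using (Pointwise)
open import Data.List using (List)
open import Data.List.Relation.Unary.Any using (Any)
open import Data.List.Relation.Unary.All using (All)

-- A monomial X_d^{i_d} ⋯ X_0^{i_0} Y^j in K[X_d,…,X_0,Y] (d+2 variables),
-- represented by its exponent vector (i_d, …, i_0, j).
Monomial : ℕ → Set
Monomial d = Vec ℕ (suc (suc d))

deg : ∀ {d} → Monomial d → ℕ
deg m = sum m

_∣ₘ_ : ∀ {d} → Monomial d → Monomial d → Set
m ∣ₘ n = Pointwise _≤_ m n

-- The monomial ideal ⟨G⟩ generated by a finite set G of monomials,
-- given by the set of monomials it contains (a monomial ideal is the
-- K-span of its monomials, so it is determined by this set).
⟨_⟩ : ∀ {d} → List (Monomial d) → Monomial d → Set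
⟨ G ⟩ m = Any (λ g → g ∣ₘ m) G

DegAtMost : ∀ {d} → List (Monomial d) → ℕ → Set
DegAtMost G n = All (λ g → deg g ≤ n) G

_⊇_ : ∀ {d} → (Monomial d → Set) → (Monomial d → Set) → Set
I ⊇ J = ∀ m → J m → I m

{-# OPTIONS --safe #-}
module Submission where

-- A monomial ideal generated in degree ≤ D is determined by its standard monomials truncated
-- at D, i.e. with every exponent above D replaced by ∞ (⊤⁺); these form a subset of the finite
-- box {0,…,D,∞}ⁿ. Thanks to ∞, ⟨Gᵢ⟩ ⊇ ⟨Gⱼ⟩ holds as soon as every truncated standard monomial
-- of Gᵢ lies below one of Gⱼ, even when Gᵢ and Gⱼ are truncated at different degrees. The
-- pointwise order on (ℕ ∪ {∞})ⁿ is almost full (Dickson), hence so is the induced Hoare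
-- preorder on finite sets; as the i-th set ranges over the finitely many subsets of a box that
-- depends only on l + i, recursion on the almost-full proof bounds the length M of a sequence
-- without such a pair (a fan argument).

open import Defs
open import Data.Nat using (ℕ; zero; suc; _+_; _≤_; z≤n; s≤s; z<s; s<s; _≤?_; _≟_)
open import Data.Nat.Properties
  using (≤-refl; ≤-trans; ≤-reflexive; ≤∧≢⇒<; ≰⇒≥; m≤m+n; m≤n+m)
open import Data.Fin using (Fin; toℕ; _<_; zero; suc)
open import Data.List using (List; []; _∷_; _++_; map; upTo; filter; cartesianProductWith)
open import Data.List.Extrema.Nat using (max; xs≤max)
open import Data.List.Relation.Unary.Any as Any using (Any; here; there; any?)
open import Data.List.Relation.Unary.All as All using (All; []; _∷_)
open import Data.List.Relation.Unary.All.Properties using (¬Any⇒All¬)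
open import Data.List.Membership.Propositional using (_∈_; find)
open import Data.List.Membership.Propositional.Properties
  using (∈-map⁺; ∈-++⁺ˡ; ∈-++⁺ʳ; ∈-upTo⁺; ∈-filter⁺; ∈-filter⁻; ∈-cartesianProductWith⁺)
open import Data.Maybe using (fromMaybe)
open import Data.Vec as Vec using (Vec; []; _∷_; sum; uncons)
open import Data.Vec.Relation.Binary.Pointwise.Inductive as Pointwiseᵥ
  using (Pointwise; []; _∷_)
open import Data.Product using (∃; ∃₂; _×_; _,_; proj₁; proj₂; map₁)
open import Data.Product.Relation.Binary.Pointwise.NonDependent
  using () renaming (Pointwise to _×ᴿ_)
open import Data.Sum using (_⊎_; inj₁; inj₂; fromInj₁)
import Data.Sum as Sum
open import Data.Bool using (true; false)
open import Function using (_∘_; _on_)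
open import Level using (0ℓ)
open import Relation.Binary.Core using (Rel; _⇒_)
open import Relation.Binary.Definitions using (Decidable)
open import Relation.Binary.PropositionalEquality using (_≡_; _≢_; refl; sym)
open import Relation.Nullary using (¬_; Dec; yes; no; does; contradiction)
open import Relation.Nullary.Decidable using (_⊎-dec_; decidable-stable)
open import Relation.Nullary.Construct.Add.Supremum using (_⁺; ⊤⁺; [_]; ≡-dec)
open import Relation.Binary.Construct.Add.Supremum.NonStrict _≤_
  using (_≤⁺_; [_]; _≤⊤⁺; [≤]-injective; ≤⁺-dec; ≤⁺-trans)
import Relation.Unary as U
open import Relation.Unary.Properties using (∁?)

private variable
  A B : Set
  R S : Rel A 0ℓ

_↑_ : Rel A 0ℓ → A → Rel A 0ℓ
(R ↑ x) y z = R y z ⊎ R x y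

-- Vytiniotis, Coquand and Wahlstedt, "Stop when you are almost-full" (ITP 2012): an inductive
-- witness that every infinite sequence has i < j with R xᵢ xⱼ; R ↑ x is what remains to be
-- found once x has occurred.
data AlmostFull {A : Set} : Rel A 0ℓ → Set₁ where
  full  : (∀ x y → R x y) → AlmostFull R
  later : (∀ x → AlmostFull (R ↑ x)) → AlmostFull R

almostFull-mono : R ⇒ S → AlmostFull R → AlmostFull S
almostFull-mono R⇒S (full t)  = full λ x y → R⇒S (t x y)
almostFull-mono R⇒S (later f) = later λ x → almostFull-mono (Sum.map R⇒S R⇒S) (f x)

almostFull-on : (f : B → A) → AlmostFull R → AlmostFull (R on f)
almostFull-on f (full t)  = full λ x y → t (f x) (f y)
almostFull-on f (later g) = later λ x → almostFull-on f (g (f x))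

↑-decidable : Decidable R → ∀ x → Decidable (R ↑ x)
↑-decidable R? x y z = R? y z ⊎-dec R? x y

Restricted : U.Pred A 0ℓ → Rel A 0ℓ → Rel A 0ℓ
Restricted P R y z = P y → P z × R y z

Split : U.Pred A 0ℓ → Rel A 0ℓ → Rel A 0ℓ → Rel A 0ℓ
Split P R S y z = (P y × P z × R y z) ⊎ (¬ P y × ¬ P z × S y z)

module _ {P : U.Pred A 0ℓ} (P? : U.Decidable P) where

  almostFull-restricted : AlmostFull R → AlmostFull (Restricted P R)
  almostFull-restricted {R = R} (full t) = later λ x → full λ y z → after (P? y)
    where
    after : ∀ {x y z} → Dec (P y) → (Restricted P R ↑ x) y z
    after (yes py) = inj₂ λ _ → py , t _ _
    after (no ¬py) = inj₁ λ py → contradiction py ¬py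
  almostFull-restricted {R = R} (later f) =
    later λ x → almostFull-mono (λ {y} → shift (P? y)) (almostFull-restricted (f x))
    where
    shift : ∀ {x y z} → Dec (P y) → Restricted P (R ↑ x) y z → (Restricted P R ↑ x) y z
    shift (no ¬py) _ = inj₁ λ py → contradiction py ¬py
    shift (yes py) r with r py
    ... | pz , inj₁ Ryz = inj₁ λ _ → pz , Ryz
    ... | _  , inj₂ Rxy = inj₂ λ _ → py , Rxy

module _ {P : U.Pred A 0ℓ} (P? : U.Decidable P) where

  almostFull-split : AlmostFull R → AlmostFull S → AlmostFull (Split P R S)
  split-↑ : ∀ {x} → Dec (P x) → AlmostFull R → AlmostFull S → AlmostFull (Split P R S ↑ x)

  almostFull-split r s = later λ x → split-↑ (P? x) r s

  split-↑ {R = R} {S} {x} (yes px) (later f) s =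
    almostFull-mono shift (almostFull-split (f x) s)
    where
    shift : Split P (R ↑ x) S ⇒ (Split P R S ↑ x)
    shift (inj₁ (py , pz , inj₁ Ryz)) = inj₁ (inj₁ (py , pz , Ryz))
    shift (inj₁ (py , _  , inj₂ Rxy)) = inj₂ (inj₁ (px , py , Rxy))
    shift (inj₂ outside)              = inj₁ (inj₂ outside)
  split-↑ {R = R} {S} {x} (no ¬px) r (later g) =
    almostFull-mono shift (almostFull-split r (g x))
    where
    shift : Split P R (S ↑ x) ⇒ (Split P R S ↑ x)
    shift (inj₂ (¬py , ¬pz , inj₁ Syz)) = inj₁ (inj₂ (¬py , ¬pz , Syz))
    shift (inj₂ (¬py , _   , inj₂ Sxy)) = inj₂ (inj₂ (¬px , ¬py , Sxy))
    shift (inj₁ inside)                 = inj₁ (inj₁ inside)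
  split-↑ {R = R} {S} {x} (yes px) (full t) s =
    almostFull-mono (λ {y} → classify (P? y)) (almostFull-restricted (∁? P?) s)
    where
    classify : ∀ {y z} → Dec (P y) → Restricted (U.∁ P) S y z → (Split P R S ↑ x) y z
    classify (yes py) _ = inj₂ (inj₁ (px , py , t x _))
    classify (no ¬py) r = inj₁ (inj₂ (¬py , r ¬py))
  split-↑ {R = R} {S} {x} (no ¬px) r (full t) =
    almostFull-mono (λ {y} → classify (P? y)) (almostFull-restricted P? r)
    where
    classify : ∀ {y z} → Dec (P y) → Restricted P R y z → (Split P R S ↑ x) y z
    classify (yes py) r = inj₁ (inj₁ (py , r py))
    classify (no ¬py) _ = inj₂ (inj₂ (¬px , ¬py , t x _))

Below : ℕ → Rel (ℕ × B) 0ℓ → Rel (ℕ × B) 0ℓ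
Below a S y z = a ≤ proj₁ y ⊎ (proj₁ y ≡ proj₁ z × S y z)

almostFull-below : ∀ a → AlmostFull S → AlmostFull (Below a S)
almostFull-below zero    s = full λ _ _ → inj₁ z≤n
almostFull-below {S = S} (suc a) s =
  almostFull-mono merge (almostFull-split (λ y → proj₁ y ≟ a) s (almostFull-below a s))
  where
  merge : Split (λ y → proj₁ y ≡ a) S (Below a S) ⇒ Below (suc a) S
  merge (inj₁ (refl , refl , Syz)) = inj₂ (refl , Syz)
  merge (inj₂ (y≢a , _ , inj₁ a≤y)) = inj₁ (≤∧≢⇒< a≤y (y≢a ∘ sym))
  merge (inj₂ (_ , _ , inj₂ below)) = inj₂ below

-- After x, an element y is either above x in both coordinates, or x₁ ≤ y₁ and ¬ S x₂ y₂, a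
-- class handled by recursion on the proof for S at x₂, or y₁ < x₁, where only finitely many
-- first coordinates occur.
almostFull-ℕ× : AlmostFull S → AlmostFull (_≤_ ×ᴿ S)
almostFull-ℕ× {S = S} s = later λ x → almostFull-mono (merge x)
  (almostFull-split (λ y → proj₁ x ≤? proj₁ y)
    (secondAfter s (proj₂ x)) (almostFull-below (proj₁ x) (almostFull-on proj₂ s)))
  where
  secondAfter : AlmostFull S → ∀ b → AlmostFull (λ y z → S b (proj₂ y) ⊎ (_≤_ ×ᴿ S) y z)
  secondAfter (full t)  b = full λ y _ → inj₁ (t b (proj₂ y))
  secondAfter (later g) b = almostFull-mono
    (λ { (y≤z , inj₁ Syz) → inj₂ (y≤z , Syz) ; (_ , inj₂ Sby) → inj₁ Sby })
    (almostFull-ℕ× (g b))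
  merge : ∀ x → Split (λ y → proj₁ x ≤ proj₁ y)
                      (λ y z → S (proj₂ x) (proj₂ y) ⊎ (_≤_ ×ᴿ S) y z)
                      (Below (proj₁ x) (S on proj₂))
              ⇒ ((_≤_ ×ᴿ S) ↑ x)
  merge x (inj₁ (x≤y , _ , inj₁ Sxy))       = inj₂ (x≤y , Sxy)
  merge x (inj₁ (_ , _ , inj₂ y≤z))         = inj₁ y≤z
  merge x (inj₂ (x≰y , _ , inj₁ x≤y))       = contradiction x≤y x≰y
  merge x (inj₂ (_ , _ , inj₂ (y≡z , Syz))) = inj₁ (≤-reflexive y≡z , Syz)

fromMaybe-≤⇒≤⁺ : ∀ {m n : ℕ ⁺} → m ≢ ⊤⁺ → fromMaybe 0 m ≤ fromMaybe 0 n → m ≤⁺ n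
fromMaybe-≤⇒≤⁺ {[ _ ]} {[ _ ]} _   a≤b = [ a≤b ]
fromMaybe-≤⇒≤⁺ {m}     {⊤⁺}    _   _   = m ≤⊤⁺
fromMaybe-≤⇒≤⁺ {⊤⁺}    {[ _ ]} m≢⊤ _   = contradiction refl m≢⊤

almostFull-ℕ⁺× : AlmostFull S → AlmostFull (_≤⁺_ ×ᴿ S)
almostFull-ℕ⁺× {S = S} s = almostFull-mono merge
  (almostFull-split (λ y → ≡-dec _≟_ (proj₁ y) ⊤⁺)
    (almostFull-on proj₂ s) (almostFull-on (map₁ (fromMaybe 0)) (almostFull-ℕ× s)))
  where
  merge : Split (λ y → proj₁ y ≡ ⊤⁺) (S on proj₂) ((_≤_ ×ᴿ S) on map₁ (fromMaybe 0))
          ⇒ (_≤⁺_ ×ᴿ S)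
  merge (inj₁ (_ , refl , Syz))      = (_ ≤⊤⁺) , Syz
  merge (inj₂ (y≢⊤ , _ , y≤z , Syz)) = fromMaybe-≤⇒≤⁺ y≢⊤ y≤z , Syz

almostFull-Pointwise⁺ : ∀ n → AlmostFull (Pointwise {A = ℕ ⁺} _≤⁺_ {n})
almostFull-Pointwise⁺ zero    = full λ { [] [] → [] }
almostFull-Pointwise⁺ (suc n) =
  almostFull-mono cons (almostFull-on uncons (almostFull-ℕ⁺× (almostFull-Pointwise⁺ n)))
  where
  cons : ((_≤⁺_ ×ᴿ Pointwise _≤⁺_) on uncons) ⇒ Pointwise _≤⁺_
  cons {_ ∷ _} {_ ∷ _} (x≤y , xs≤ys) = x≤y ∷ xs≤ys

Hoare : Rel A 0ℓ → Rel (List A) 0ℓ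
Hoare R xs ys = All (λ x → Any (R x) ys) xs

Hoare-↑⇒Hoare : ∀ {x ys zs} → ¬ Any (R x) ys → Hoare (R ↑ x) ys zs → Hoare R ys zs
Hoare-↑⇒Hoare x≰ys ys≤zs =
  All.zipWith (λ (x≰y , y≤zs) → Any.map (fromInj₁ λ x≤y → contradiction x≤y x≰y) y≤zs)
              (¬Any⇒All¬ _ x≰ys , ys≤zs)

almostFull-Hoare : Decidable R → AlmostFull R → AlmostFull (Hoare R)
almostFull-Hoare R? (full t) = later λ xs → full λ
  { []      _ → inj₁ []
  ; (y ∷ _) _ → inj₂ (All.universal (λ x → here (t x y)) xs) }
almostFull-Hoare {R = R} R? (later f) = later after
  where
  after : ∀ xs → AlmostFull (Hoare R ↑ xs)
  after []       = full λ _ _ → inj₂ []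
  after (x ∷ xs) = almostFull-mono merge
    (almostFull-split (any? (R? x)) (after xs) (almostFull-Hoare (↑-decidable R? x) (f x)))
    where
    merge : Split (Any (R x)) (Hoare R ↑ xs) (Hoare (R ↑ x)) ⇒ (Hoare R ↑ (x ∷ xs))
    merge (inj₁ (_ , _ , inj₁ ys≤zs))    = inj₁ ys≤zs
    merge (inj₁ (x≤ys , _ , inj₂ xs≤ys)) = inj₂ (x≤ys ∷ xs≤ys)
    merge (inj₂ (x≰ys , _ , ys≤zs))      = inj₁ (Hoare-↑⇒Hoare x≰ys ys≤zs)

-- Fan argument: when the i-th term of a sequence ranges over the finite list L i, recursion on
-- the almost-full proof bounds the length of sequences without an R-related pair.
fanBound : {R : Rel A 0ℓ} → AlmostFull R → (ℕ → List A) → ℕ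
fanBound (full _)  L = 1
fanBound (later f) L = suc (max 0 (map (λ x → fanBound (f x) (L ∘ suc)) (L 0)))

fanBound-good : ∀ {R : Rel A 0ℓ} {M} (p : AlmostFull R) (L : ℕ → List A) → fanBound p L ≤ M →
                (x : Fin (suc M) → A) → (∀ i → x i ∈ L (toℕ i)) →
                ∃₂ λ i j → i < j × R (x i) (x j)
fanBound-good (full t) L (s≤s z≤n) x _ = zero , suc zero , z<s , t _ _
fanBound-good (later f) L (s≤s bound≤M) x x∈L
  with fanBound-good (f (x zero)) (L ∘ suc) (≤-trans tail≤max bound≤M) (x ∘ suc) (x∈L ∘ suc)
  where
  tail≤max : fanBound (f (x zero)) (L ∘ suc) ≤ max 0 (map (λ y → fanBound (f y) (L ∘ suc)) (L 0))
  tail≤max = All.lookup (xs≤max 0 _) (∈-map⁺ (λ y → fanBound (f y) (L ∘ suc)) (x∈L zero))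
... | i , j , i<j , inj₁ Rxᵢxⱼ = suc i , suc j , s<s i<j , Rxᵢxⱼ
... | i , _ , _   , inj₂ Rx₀xᵢ = zero , suc i , z<s , Rx₀xᵢ

embed : ∀ {n} → Vec ℕ n → Vec (ℕ ⁺) n
embed = Vec.map [_]

cap : ℕ → ℕ → ℕ ⁺
cap D k with k ≤? D
... | yes _ = [ k ]
... | no _  = ⊤⁺

truncate : ∀ {n} → ℕ → Vec ℕ n → Vec (ℕ ⁺) n
truncate D = Vec.map (cap D)

[k]≤cap : ∀ D k → [ k ] ≤⁺ cap D k
[k]≤cap D k with k ≤? D
... | yes _ = [ ≤-refl ]
... | no _  = [ k ] ≤⊤⁺

cap-reflects : ∀ {a D} k → a ≤ D → [ a ] ≤⁺ cap D k → a ≤ k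
cap-reflects {D = D} k a≤D a≤cap with k ≤? D
... | yes _  = [≤]-injective a≤cap
... | no k≰D = ≤-trans a≤D (≰⇒≥ k≰D)

embed≤truncate : ∀ {n} D (m : Vec ℕ n) → Pointwise _≤⁺_ (embed m) (truncate D m)
embed≤truncate D []      = []
embed≤truncate D (k ∷ m) = [k]≤cap D k ∷ embed≤truncate D m

truncate-reflects : ∀ {n D} (g m : Vec ℕ n) → sum g ≤ D →
                    Pointwise _≤⁺_ (embed g) (truncate D m) → Pointwise _≤_ g m
truncate-reflects []      []      _     []            = []
truncate-reflects (a ∷ g) (k ∷ m) a+g≤D (a≤cap ∷ g≤m) =
  cap-reflects k (≤-trans (m≤m+n a (sum g)) a+g≤D) a≤cap
  ∷ truncate-reflects g m (≤-trans (m≤n+m (sum g) a) a+g≤D) g≤m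

capValues : ℕ → List (ℕ ⁺)
capValues D = ⊤⁺ ∷ map [_] (upTo (suc D))

cap∈capValues : ∀ D k → cap D k ∈ capValues D
cap∈capValues D k with k ≤? D
... | yes k≤D = there (∈-map⁺ [_] (∈-upTo⁺ (s≤s k≤D)))
... | no _    = here refl

box : ∀ n → ℕ → List (Vec (ℕ ⁺) n)
box zero    D = [] ∷ []
box (suc n) D = cartesianProductWith _∷_ (capValues D) (box n D)

truncate∈box : ∀ {n} D (m : Vec ℕ n) → truncate D m ∈ box n D
truncate∈box D []      = here refl
truncate∈box D (k ∷ m) = ∈-cartesianProductWith⁺ _∷_ (cap∈capValues D k) (truncate∈box D m)

sublists : List A → List (List A)
sublists []       = [] ∷ []
sublists (x ∷ xs) = map (x ∷_) (sublists xs) ++ sublists xs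

filter∈sublists : ∀ {P : U.Pred A 0ℓ} (P? : U.Decidable P) xs → filter P? xs ∈ sublists xs
filter∈sublists P? []       = here refl
filter∈sublists P? (x ∷ xs) with does (P? x)
... | true  = ∈-++⁺ˡ (∈-map⁺ (x ∷_) (filter∈sublists P? xs))
... | false = ∈-++⁺ʳ _ (filter∈sublists P? xs)

Monomial⁺ : ℕ → Set
Monomial⁺ d = Vec (ℕ ⁺) (suc (suc d))

⟨_⟩⁺ : ∀ {d} → List (Monomial d) → Monomial⁺ d → Set
⟨ G ⟩⁺ w = Any (λ g → Pointwise _≤⁺_ (embed g) w) G

⟨_⟩? : ∀ {d} (G : List (Monomial d)) → U.Decidable ⟨ G ⟩
⟨ G ⟩? m = any? (λ g → Pointwiseᵥ.decidable _≤?_ g m) G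

⟨_⟩⁺? : ∀ {d} (G : List (Monomial d)) → U.Decidable ⟨ G ⟩⁺
⟨ G ⟩⁺? w = any? (λ g → Pointwiseᵥ.decidable (≤⁺-dec _≤?_) (embed g) w) G

⟨⟩⇒⟨⟩⁺ : ∀ {d} {G : List (Monomial d)} {m} → ⟨ G ⟩ m → ⟨ G ⟩⁺ (embed m)
⟨⟩⇒⟨⟩⁺ = Any.map (Pointwiseᵥ.map⁺ [_])

⟨⟩⁺-upward : ∀ {d} {G : List (Monomial d)} {v w} →
             Pointwise _≤⁺_ v w → ⟨ G ⟩⁺ v → ⟨ G ⟩⁺ w
⟨⟩⁺-upward v≤w = Any.map λ g≤v → Pointwiseᵥ.trans (≤⁺-trans ≤-trans) g≤v v≤w

⟨⟩⁺-truncate : ∀ {d D} {G : List (Monomial d)} {m} →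
               DegAtMost G D → ⟨ G ⟩⁺ (truncate D m) → ⟨ G ⟩ m
⟨⟩⁺-truncate (g≤D ∷ _) (here g≤t)  = here (truncate-reflects _ _ g≤D g≤t)
⟨⟩⁺-truncate (_ ∷ G≤D) (there G≤t) = there (⟨⟩⁺-truncate G≤D G≤t)

standard : ∀ {d} → ℕ → List (Monomial d) → List (Monomial⁺ d)
standard D G = filter (∁? ⟨ G ⟩⁺?) (box _ D)

standard-Hoare⇒⊇ : ∀ {d D D′} {G G′ : List (Monomial d)} → DegAtMost G D →
                   Hoare (Pointwise _≤⁺_) (standard D G) (standard D′ G′) → ⟨ G ⟩ ⊇ ⟨ G′ ⟩
standard-Hoare⇒⊇ {D = D} {D′} {G} {G′} G≤D G≤G′ m m∈G′ =
  decidable-stable (⟨ G ⟩? m) λ m∉G →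
    let t∈standard = ∈-filter⁺ (∁? ⟨ G ⟩⁺?) (truncate∈box D m) (m∉G ∘ ⟨⟩⁺-truncate G≤D)
        w , w∈standard′ , t≤w = find (All.lookup G≤G′ t∈standard)
        m≤w = Pointwiseᵥ.trans (≤⁺-trans ≤-trans) (embed≤truncate D m) t≤w
    in proj₂ (∈-filter⁻ (∁? ⟨ G′ ⟩⁺?) {xs = box _ D′} w∈standard′)
             (⟨⟩⁺-upward m≤w (⟨⟩⇒⟨⟩⁺ m∈G′))

mainTheorem1 : (d l : ℕ) → ∃ λ (M : ℕ) →
    (G : Fin (suc M) → List (Monomial d)) →
    (∀ i → DegAtMost (G i) (l + toℕ i)) →
    ∃₂ λ (i j : Fin (suc M)) → i < j × (⟨ G i ⟩ ⊇ ⟨ G j ⟩)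
mainTheorem1 d l = fanBound hoare candidates , λ G G≤ →
  let i , j , i<j , Gᵢ≤Gⱼ = fanBound-good hoare candidates ≤-refl
                              (λ i → standard (l + toℕ i) (G i))
                              (λ i → filter∈sublists (∁? ⟨ G i ⟩⁺?) (box _ (l + toℕ i)))
  in i , j , i<j , standard-Hoare⇒⊇ (G≤ i) Gᵢ≤Gⱼ
  where
  hoare : AlmostFull (Hoare (Pointwise _≤⁺_))
  hoare = almostFull-Hoare (Pointwiseᵥ.decidable (≤⁺-dec _≤?_))
                           (almostFull-Pointwise⁺ (suc (suc d)))
  candidates : ℕ → List (List (Monomial⁺ d))
  candidates k = sublists (box _ (l + k))
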